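{- Let $E$ be a finite guarded recursive specification over $\mathrm{TSP}^{\bullet}$ in Greibach normal form, and let $X$ be a name defined in $E$. Then there exists a pushdown automaton $\mathcal{M}$ such that the transition system $\mathcal{T}(X)$ associated with $X$ is strongly bisimilar to the transition system $\mathcal{T}(\mathcal{M})$ associated with $\mathcal{M}$.
   Context: $\mathcal{A}_\tau=\mathcal{A}\cup\{\tau\}$ is a set of actions ($\tau$ internal). $\mathrm{TSP}^{\bullet}$ process expressions: $P::=\mathbf{0}\mid\mathbf{1}\mid a.P\mid P\bullet P\mid P+P\mid N$ ($a\in\mathcal{A}_\tau$, $N$ a name). A recursive specification $E$ is a set of equations $N\overset{def}{=}P$ with at most one per name and a defining equation for every name occurring in a right-hand side; it is guarded if every occurrence of a name in a right-hand side is within the scope of a prefix $a.$ with $a\in\mathcal{A}$ (not $\tau$). It is in Greibach normal form if every equation has the form $X=\sum_{i\in I_X}\alpha_i.\xi_i$ possibly with an additional summand $\mathbf{1}$, where $I_X$ is finite (empty sum denotes $\mathbf{0}$), $\alpha_i\in\mathcal{A}_\tau$ and each $\xi_i$ is a sequential composition (with $\bullet$) of names (the empty sequence denoting $\mathbf{1}$). Operational semantics (least relations, well-supported because of the negative premise): $\mathbf{1}\downarrow$; $a.P\xrightarrow{a}P$; $+$ inherits transitions and termination from either summand; $P_1\bullet P_2\downarrow$ if $P_1\downarrow$ and $P_2\downarrow$; $P_1\xrightarrow{a}P_1'$ implies $P_1\bullet P_2\xrightarrow{a}P_1'\bullet P_2$; if $P_1\downarrow$, $P_2\xrightarrow{a}P_2'$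 and $P_1$ has no outgoing transition, then $P_1\bullet P_2\xrightarrow{a}P_2'$; a name $N$ with $N\overset{def}{=}P$ in $E$ has the transitions and termination of $P$. $\mathcal{T}(P)$ is the transition system with states the expressions reachable from $P$, the induced transitions, initial state $P$ and terminating states those $Q$ with $Q\downarrow$. A pushdown automaton is $\mathcal{M}=(S,\Sigma,\mathcal{D},\to,\uparrow,Z,\downarrow)$ with $S$ a finite set of states, $\Sigma\subseteq\mathcal{A}_\tau$ finite, $\mathcal{D}$ a finite set of stack symbols, $\to\subseteq S\times\mathcal{D}\times\Sigma\times\mathcal{D}^*\times S$ finite (written $s\xrightarrow{a[d/\delta]}t$), initial state $\uparrow\in S$, initial stack symbol $Z\in\mathcal{D}$, accepting states $\downarrow\subseteq S$. $\mathcal{T}(\mathcal{M})$ has states $(s,\delta)$ with $s\in S,\delta\in\mathcal{D}^*$, transitions $(s,d\delta)\xrightarrow{a}(t,\delta'\delta)$ iff $s\xrightarrow{a[d/\delta']}t$, initial state $(\uparrow,Z)$, and terminating states $(s,\delta)$ with $s\in\downarrow$. A strong bisimulation on a transition system is a symmetric relation $R$ such that $sRt$ implies: if $s\xrightarrow{a}s'$ then $t\xrightarrow{a}t'$ with $s'Rt'$; and if $s\downarrow$ then $t\downarrow$. Two transition systems are strongly bisimilar if their initial states are related by a strong bisimulation on their disjoint union. -}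

module Defs where

open import Data.Nat using (ℕ)
open import Data.Fin using (Fin)
open import Data.Fin.Subset using (Subset; _∈_)
open import Data.Maybe using (Maybe; just; nothing)
open import Data.List using (List; []; _∷_; _++_)
open import Data.List.Membership.Propositional renaming (_∈_ to _∈ₗ_)
open import Data.Product using (Σ; _×_; _,_; proj₁)
open import Data.Sum using (_⊎_; inj₁; inj₂)
open import Relation.Nullary using (¬_)

Actτ : Set → Set
Actτ A = Maybe A

τ : {A : Set} → Actτ A
τ = nothing

infixr 6 _∙_
infixr 5 _⊕_

data Proc (A : Set) (N : Set) : Set where
  𝟎    : Proc A N
  𝟏    : Proc A N
  _∙_  : Actτ A → Proc A N → Proc A N
  _•_  : Proc A N → Proc A N → Proc A N
  _⊕_  : Proc A N → Proc A N → Proc A N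
  name : N → Proc A N

Spec : Set → ℕ → Set
Spec A n = Fin n → Proc A (Fin n)

-- Guardedness: every occurrence of a name is in the scope of a prefix a.
-- with a ∈ 𝒜 (not τ).

data GuardedExpr {A N : Set} : Proc A N → Set where
  g𝟎   : GuardedExpr 𝟎
  g𝟏   : GuardedExpr 𝟏
  gact : ∀ (a : A) P → GuardedExpr (just a ∙ P)
  gτ   : ∀ {P} → GuardedExpr P → GuardedExpr (τ ∙ P)
  g•   : ∀ {P Q} → GuardedExpr P → GuardedExpr Q → GuardedExpr (P • Q)
  g⊕   : ∀ {P Q} → GuardedExpr P → GuardedExpr Q → GuardedExpr (P ⊕ Q)

Guarded : {A : Set} {n : ℕ} → Spec A n → Set
Guarded E = ∀ X → GuardedExpr (E X)

-- Greibach normal form: each right-hand side is a (finite) sum of summands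
-- α.ξ with ξ a sequential composition of names (𝟏 = empty sequence),
-- possibly with a summand 𝟏; 𝟎 is the empty sum.

data SeqNames {A N : Set} : Proc A N → Set where
  s𝟏    : SeqNames 𝟏
  sname : ∀ X → SeqNames (name X)
  s•    : ∀ {P Q} → SeqNames P → SeqNames Q → SeqNames (P • Q)

data GNFSum {A N : Set} : Proc A N → Set where
  n𝟎   : GNFSum 𝟎
  n𝟏   : GNFSum 𝟏
  nact : ∀ (α : Actτ A) {ξ} → SeqNames ξ → GNFSum (α ∙ ξ)
  n⊕   : ∀ {P Q} → GNFSum P → GNFSum Q → GNFSum (P ⊕ Q)

GreibachNF : {A : Set} {n : ℕ} → Spec A n → Set
GreibachNF E = ∀ X → GNFSum (E X)

module Semantics {A : Set} {n : ℕ} (E : Spec A n) where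

  P' : Set
  P' = Proc A (Fin n)

  data _↓ : P' → Set where
    𝟏↓    : 𝟏 ↓
    ⊕↓ˡ   : ∀ {P Q} → P ↓ → (P ⊕ Q) ↓
    ⊕↓ʳ   : ∀ {P Q} → Q ↓ → (P ⊕ Q) ↓
    •↓    : ∀ {P Q} → P ↓ → Q ↓ → (P • Q) ↓
    name↓ : ∀ {X} → E X ↓ → name X ↓

  -- positive (well-supported) derivation of the negative literal
  -- "P has no outgoing transition"
  data NoStep : P' → Set where
    ns𝟎    : NoStep 𝟎
    ns𝟏    : NoStep 𝟏
    ns⊕    : ∀ {P Q} → NoStep P → NoStep Q → NoStep (P ⊕ Q)
    ns•¬↓  : ∀ {P Q} → NoStep P → ¬ (P ↓) → NoStep (P • Q)
    ns•    : ∀ {P Q} → NoStep P → NoStep Q → NoStep (P • Q)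
    nsname : ∀ {X} → NoStep (E X) → NoStep (name X)

  data _⟶[_]_ : P' → Actτ A → P' → Set where
    pre   : ∀ {a P} → (a ∙ P) ⟶[ a ] P
    ⊕ˡ    : ∀ {P Q a P₁} → P ⟶[ a ] P₁ → (P ⊕ Q) ⟶[ a ] P₁
    ⊕ʳ    : ∀ {P Q a Q₁} → Q ⟶[ a ] Q₁ → (P ⊕ Q) ⟶[ a ] Q₁
    •ˡ    : ∀ {P Q a P₁} → P ⟶[ a ] P₁ → (P • Q) ⟶[ a ] (P₁ • Q)
    •ʳ    : ∀ {P Q a Q₁} → P ↓ → NoStep P → Q ⟶[ a ] Q₁ → (P • Q) ⟶[ a ] Q₁
    nameₜ : ∀ {X a P₁} → E X ⟶[ a ] P₁ → name X ⟶[ a ] P₁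

  data Reach (P : P') : P' → Set where
    here : Reach P P
    next : ∀ {Q a Q₁} → Reach P Q → Q ⟶[ a ] Q₁ → Reach P Q₁

record LTS (A : Set) : Set₁ where
  field
    State : Set
    _⟶⟨_⟩_ : State → Actτ A → State → Set
    term  : State → Set
    init  : State

open LTS

𝒯 : {A : Set} {n : ℕ} → Spec A n → Proc A (Fin n) → LTS A
𝒯 E P = record
  { State  = Σ (Proc _ _) (Reach P)
  ; _⟶⟨_⟩_ = λ s a t → proj₁ s ⟶[ a ] proj₁ t
  ; term   = λ s → proj₁ s ↓
  ; init   = P , here
  }
  where open Semantics E

record PDA (A : Set) : Set where
  field
    nS    : ℕ
    Σₐ    : List (Actτ A)
    nD    : ℕ
    trans : List (Fin nS × Fin nD × Actτ A × List (Fin nD) × Fin nS)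
                                   -- finite transition relation  s -a[d/δ]→ t
    trans⊆Σ : ∀ {s d a δ t} → (s , d , a , δ , t) ∈ₗ trans → a ∈ₗ Σₐ
    start : Fin nS
    Z     : Fin nD
    accept : Subset nS

module _ {A : Set} (M : PDA A) where
  open PDA M

  data PDAStep : Fin nS × List (Fin nD) → Actτ A → Fin nS × List (Fin nD) → Set where
    pstep : ∀ {s d a δ' t δ} → (s , d , a , δ' , t) ∈ₗ trans →
            PDAStep (s , d ∷ δ) a (t , δ' ++ δ)

𝒯ᴹ : {A : Set} → PDA A → LTS A
𝒯ᴹ M = record
  { State  = Fin nS × List (Fin nD)
  ; _⟶⟨_⟩_ = PDAStep M
  ; term   = λ c → proj₁ c ∈ accept
  ; init   = start , Z ∷ []
  }
  where open PDA M

data UStep {A : Set} (T₁ T₂ : LTS A) :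
     State T₁ ⊎ State T₂ → Actτ A → State T₁ ⊎ State T₂ → Set where
  step₁ : ∀ {s a s'} → _⟶⟨_⟩_ T₁ s a s' → UStep T₁ T₂ (inj₁ s) a (inj₁ s')
  step₂ : ∀ {s a s'} → _⟶⟨_⟩_ T₂ s a s' → UStep T₁ T₂ (inj₂ s) a (inj₂ s')

data UTerm {A : Set} (T₁ T₂ : LTS A) : State T₁ ⊎ State T₂ → Set where
  term₁ : ∀ {s} → term T₁ s → UTerm T₁ T₂ (inj₁ s)
  term₂ : ∀ {s} → term T₂ s → UTerm T₁ T₂ (inj₂ s)

_⊎ᴸ_ : {A : Set} → LTS A → LTS A → LTS A
T₁ ⊎ᴸ T₂ = record
  { State  = State T₁ ⊎ State T₂
  ; _⟶⟨_⟩_ = UStep T₁ T₂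
  ; term   = UTerm T₁ T₂
  ; init   = inj₁ (init T₁)
  }

record IsStrongBisimulation {A : Set} (T : LTS A)
       (R : State T → State T → Set) : Set where
  field
    symmetric : ∀ {s t} → R s t → R t s
    transfer  : ∀ {s t a s'} → R s t → _⟶⟨_⟩_ T s a s' →
                Σ (State T) λ t' → _⟶⟨_⟩_ T t a t' × R s' t'
    termination : ∀ {s t} → R s t → term T s → term T t

StronglyBisimilar : {A : Set} → LTS A → LTS A → Set₁
StronglyBisimilar T₁ T₂ =
  Σ (State (T₁ ⊎ᴸ T₂) → State (T₁ ⊎ᴸ T₂) → Set) λ R →
    IsStrongBisimulation (T₁ ⊎ᴸ T₂) R × R (inj₁ (init T₁)) (inj₂ (init T₂))

-- Every reachable state of 𝒯(X) is a sequential composition of names, and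
-- in Greibach normal form such a state is determined, up to bisimilarity,
-- by the list of its names with the idle ones (terminating, no transitions)
-- erased.  That list is kept on the stack: the top name is popped and the
-- names of one of its summands pushed.  A state terminates iff all names
-- on the stack terminate; this is the control state, and each stack symbol
-- carries it for the names below so that it survives a pop.  If X itself
-- is idle the stack would be empty, and a one-state automaton does the job.

module Submission where

open import Defs
open import Data.Nat using (ℕ; _*_)
open import Data.Fin using (Fin; zero; suc; combine)
open import Data.Fin.Properties using (combine-injective)
open import Data.Fin.Subset using (⁅_⁆; ⊤) renaming (_∈_ to _∈ˢ_)
open import Data.Fin.Subset.Properties using (x∈⁅x⁆; ∈⊤)
open import Data.Bool using (Bool; true; false; T; _∧_)
open import Data.Bool.Properties using (T-∧; ∧-assoc)
open import Data.List using (List; []; _∷_; _++_; foldr; map; concatMap; cartesianProduct; allFin)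
open import Data.List.Properties using (++-assoc; ++-identityʳ; ++-conicalˡ; ++-conicalʳ; ∷-injective; foldr-++)
open import Data.List.Relation.Unary.Any using (here; there)
open import Data.List.Membership.Propositional using (_∈_; lose; find)
open import Data.List.Membership.Propositional.Properties
  using (∈-map⁺; ∈-map⁻; ∈-++⁺ˡ; ∈-++⁺ʳ; ∈-++⁻; ∈-concatMap⁺; ∈-concatMap⁻; ∈-cartesianProduct⁺; ∈-allFin)
open import Data.Product using (Σ; _×_; _,_; proj₁; proj₂; uncurry)
open import Data.Sum using (_⊎_; inj₁; inj₂; [_,_])
open import Data.Unit using (tt)
open import Data.Empty using (⊥-elim)
open import Function using (_∘_; Equivalence)
open import Relation.Nullary using (¬_; Dec; yes; no)
open import Relation.Nullary.Decidable using (⌊_⌋; map′; _×-dec_; _⊎-dec_; toWitness; fromWitness)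
open import Relation.Binary.PropositionalEquality using (_≡_; refl; sym; trans; cong; cong₂; subst)

open LTS
open Equivalence using (to; from)

module _ {A : Set} (T₁ T₂ : LTS A) where

  record IsBisimulationBetween (S : State T₁ → State T₂ → Set) : Set where
    field
      forth : ∀ {s t a s′} → S s t → _⟶⟨_⟩_ T₁ s a s′ →
              Σ (State T₂) λ t′ → _⟶⟨_⟩_ T₂ t a t′ × S s′ t′
      back  : ∀ {s t a t′} → S s t → _⟶⟨_⟩_ T₂ t a t′ →
              Σ (State T₁) λ s′ → _⟶⟨_⟩_ T₁ s a s′ × S s′ t′
      term⇒ : ∀ {s t} → S s t → term T₁ s → term T₂ t
      term⇐ : ∀ {s t} → S s t → term T₂ t → term T₁ s

  data Symmetrise (S : State T₁ → State T₂ → Set) : State (T₁ ⊎ᴸ T₂) → State (T₁ ⊎ᴸ T₂) → Set where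
    ⟨_⟩  : ∀ {s t} → S s t → Symmetrise S (inj₁ s) (inj₂ t)
    ⟨_⟩⁻ : ∀ {s t} → S s t → Symmetrise S (inj₂ t) (inj₁ s)

  bisimulation⇒bisimilar : ∀ S → IsBisimulationBetween S → S (init T₁) (init T₂) →
                           StronglyBisimilar T₁ T₂
  bisimulation⇒bisimilar S bisim s₀ = Symmetrise S , isBisimulation , ⟨ s₀ ⟩
    where
      open IsBisimulationBetween bisim

      isBisimulation : IsStrongBisimulation (T₁ ⊎ᴸ T₂) (Symmetrise S)
      isBisimulation .IsStrongBisimulation.symmetric ⟨ r ⟩  = ⟨ r ⟩⁻
      isBisimulation .IsStrongBisimulation.symmetric ⟨ r ⟩⁻ = ⟨ r ⟩
      isBisimulation .IsStrongBisimulation.transfer ⟨ r ⟩ (step₁ st) =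
        let t′ , st′ , r′ = forth r st in inj₂ t′ , step₂ st′ , ⟨ r′ ⟩
      isBisimulation .IsStrongBisimulation.transfer ⟨ r ⟩⁻ (step₂ st) =
        let s′ , st′ , r′ = back r st in inj₁ s′ , step₁ st′ , ⟨ r′ ⟩⁻
      isBisimulation .IsStrongBisimulation.termination ⟨ r ⟩  (term₁ t) = term₂ (term⇒ r t)
      isBisimulation .IsStrongBisimulation.termination ⟨ r ⟩⁻ (term₂ t) = term₁ (term⇐ r t)

Stuck : {A : Set} (T : LTS A) → State T → Set
Stuck T s = ∀ {a s′} → ¬ (_⟶⟨_⟩_ T s a s′)

stuck-bisimilar : {A : Set} (T₁ T₂ : LTS A) →
                  Stuck T₁ (init T₁) → term T₁ (init T₁) →
                  Stuck T₂ (init T₂) → term T₂ (init T₂) → StronglyBisimilar T₁ T₂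
stuck-bisimilar T₁ T₂ stuck₁ final₁ stuck₂ final₂ =
  bisimulation⇒bisimilar T₁ T₂ Initial bisim (refl , refl)
  where
    Initial : State T₁ → State T₂ → Set
    Initial s t = s ≡ init T₁ × t ≡ init T₂

    bisim : IsBisimulationBetween T₁ T₂ Initial
    bisim .IsBisimulationBetween.forth (refl , refl) st = ⊥-elim (stuck₁ st)
    bisim .IsBisimulationBetween.back  (refl , refl) st = ⊥-elim (stuck₂ st)
    bisim .IsBisimulationBetween.term⇒ (refl , refl) _ = final₂
    bisim .IsBisimulationBetween.term⇐ (refl , refl) _ = final₁

halt : {A : Set} → PDA A
halt = record
  { nS = 1 ; Σₐ = [] ; nD = 1 ; trans = [] ; trans⊆Σ = λ ()
  ; start = zero ; Z = zero ; accept = ⊤ }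

halt-stuck : {A : Set} {c : Fin 1 × List (Fin 1)} → Stuck (𝒯ᴹ (halt {A})) c
halt-stuck (pstep ())

module GreibachSemantics {A : Set} {n : ℕ} (E : Spec A n) where
  open Semantics E hiding (P')

  Expr : Set
  Expr = Proc A (Fin n)

  private variable
    P Q P₁ : Expr
    a : Actτ A

  noStep-stuck : NoStep P → ¬ (P ⟶[ a ] P₁)
  noStep-stuck (ns⊕ p _)     (⊕ˡ st)     = noStep-stuck p st
  noStep-stuck (ns⊕ _ q)     (⊕ʳ st)     = noStep-stuck q st
  noStep-stuck (ns•¬↓ p _)   (•ˡ st)     = noStep-stuck p st
  noStep-stuck (ns•¬↓ _ ¬p↓) (•ʳ p↓ _ _) = ¬p↓ p↓
  noStep-stuck (ns• p _)     (•ˡ st)     = noStep-stuck p st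
  noStep-stuck (ns• _ q)     (•ʳ _ _ st) = noStep-stuck q st
  noStep-stuck (nsname p)    (nameₜ st)  = noStep-stuck p st

  branches : GNFSum P → List (Actτ A × Expr)
  branches n𝟎             = []
  branches n𝟏             = []
  branches (nact α {ξ} _) = (α , ξ) ∷ []
  branches (n⊕ h k)       = branches h ++ branches k

  step⇒branch : (h : GNFSum P) → P ⟶[ a ] P₁ → (a , P₁) ∈ branches h
  step⇒branch (nact _ _) pre      = here refl
  step⇒branch (n⊕ h k)   (⊕ˡ st)  = ∈-++⁺ˡ (step⇒branch h st)
  step⇒branch (n⊕ h k)   (⊕ʳ st)  = ∈-++⁺ʳ (branches h) (step⇒branch k st)

  branch⇒step : (h : GNFSum P) → (a , P₁) ∈ branches h → P ⟶[ a ] P₁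
  branch⇒step (nact _ _) (here refl) = pre
  branch⇒step (n⊕ h k)   m =
    [ ⊕ˡ ∘ branch⇒step h , ⊕ʳ ∘ branch⇒step k ] (∈-++⁻ (branches h) m)

  branch-seqNames : (h : GNFSum P) → (a , P₁) ∈ branches h → SeqNames P₁
  branch-seqNames (nact _ s) (here refl) = s
  branch-seqNames (n⊕ h k)   m =
    [ branch-seqNames h , branch-seqNames k ] (∈-++⁻ (branches h) m)

  ↓? : GNFSum P → Dec (P ↓)
  ↓? n𝟎         = no λ ()
  ↓? n𝟏         = yes 𝟏↓
  ↓? (nact _ _) = no λ ()
  ↓? (n⊕ h k)   = map′ [ ⊕↓ˡ , ⊕↓ʳ ] (λ { (⊕↓ˡ t) → inj₁ t ; (⊕↓ʳ t) → inj₂ t }) (↓? h ⊎-dec ↓? k)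

  noStep? : GNFSum P → Dec (NoStep P)
  noStep? n𝟎         = yes ns𝟎
  noStep? n𝟏         = yes ns𝟏
  noStep? (nact _ _) = no λ ()
  noStep? (n⊕ h k)   = map′ (uncurry ns⊕) (λ { (ns⊕ p q) → p , q }) (noStep? h ×-dec noStep? k)

module PushdownConstruction {A : Set} {n : ℕ} (E : Spec A n) (gnf : GreibachNF E) where
  open Semantics E hiding (P')
  open GreibachSemantics E

  private variable
    Q Q₁ : Expr
    a : Actτ A
    b : Bool
    L L′ M : List (Fin n)

  Idle : Fin n → Set
  Idle Y = name Y ↓ × NoStep (name Y)

  idle? : ∀ Y → Dec (Idle Y)
  idle? Y = map′ (λ (t , ns) → name↓ t , nsname ns) (λ { (name↓ t , nsname ns) → t , ns })
                 (↓? (gnf Y) ×-dec noStep? (gnf Y))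

  -- Only meaningful on sequential compositions of names (SeqNames).
  stack : Expr → List (Fin n)
  stack (name Y) with idle? Y
  ... | yes _ = []
  ... | no _  = Y ∷ []
  stack (P • R) = stack P ++ stack R
  stack _       = []

  quiescent⇒stack-empty : SeqNames Q → Q ↓ → NoStep Q → stack Q ≡ []
  quiescent⇒stack-empty s𝟏 _ _ = refl
  quiescent⇒stack-empty (sname Y) t ns with idle? Y
  ... | yes _    = refl
  ... | no ¬idle = ⊥-elim (¬idle (t , ns))
  quiescent⇒stack-empty (s• p q) (•↓ t _) (ns•¬↓ _ ¬t) = ⊥-elim (¬t t)
  quiescent⇒stack-empty (s• p q) (•↓ t u) (ns• x y) =
    cong₂ _++_ (quiescent⇒stack-empty p t x) (quiescent⇒stack-empty q u y)

  stack-empty⇒quiescent : SeqNames Q → stack Q ≡ [] → Q ↓ × NoStep Q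
  stack-empty⇒quiescent s𝟏 _ = 𝟏↓ , ns𝟏
  stack-empty⇒quiescent (sname Y) with idle? Y
  ... | yes idle = λ _ → idle
  ... | no _     = λ ()
  stack-empty⇒quiescent (s• {P} {R} p q) e =
    let t , x = stack-empty⇒quiescent p (++-conicalˡ (stack P) (stack R) e)
        u , y = stack-empty⇒quiescent q (++-conicalʳ (stack P) (stack R) e)
    in •↓ t u , ns• x y

  terminates : Fin n → Bool
  terminates Y = ⌊ ↓? (gnf Y) ⌋

  allTerminate : Bool → List (Fin n) → Bool
  allTerminate = foldr (λ Y r → terminates Y ∧ r)

  allTerminate-∧ : ∀ b L → allTerminate b L ≡ allTerminate true L ∧ b
  allTerminate-∧ b []      = refl
  allTerminate-∧ b (Y ∷ L) =
    trans (cong (terminates Y ∧_) (allTerminate-∧ b L)) (sym (∧-assoc (terminates Y) _ b))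

  T-allTerminate-++ : ∀ L M → T (allTerminate true (L ++ M)) →
                      T (allTerminate true L) × T (allTerminate true M)
  T-allTerminate-++ L M t =
    to T-∧ (subst T (trans (foldr-++ _ true L M) (allTerminate-∧ _ L)) t)

  T-allTerminate-++⁻ : ∀ L M → T (allTerminate true L) → T (allTerminate true M) →
                       T (allTerminate true (L ++ M))
  T-allTerminate-++⁻ L M t u =
    subst T (sym (trans (foldr-++ _ true L M) (allTerminate-∧ _ L))) (from T-∧ (t , u))

  ↓⇒allTerminate : SeqNames Q → Q ↓ → T (allTerminate true (stack Q))
  ↓⇒allTerminate s𝟏 _ = tt
  ↓⇒allTerminate (sname Y) (name↓ t) with idle? Y
  ... | yes _ = tt
  ... | no _  = from T-∧ (fromWitness t , tt)
  ↓⇒allTerminate (s• {P} {R} p q) (•↓ t u) =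
    T-allTerminate-++⁻ (stack P) (stack R) (↓⇒allTerminate p t) (↓⇒allTerminate q u)

  allTerminate⇒↓ : SeqNames Q → T (allTerminate true (stack Q)) → Q ↓
  allTerminate⇒↓ s𝟏 _ = 𝟏↓
  allTerminate⇒↓ (sname Y) with idle? Y
  ... | yes (t , _) = λ _ → t
  ... | no _        = λ t → name↓ (toWitness (proj₁ (to (T-∧ {terminates Y}) t)))
  allTerminate⇒↓ (s• {P} {R} p q) t =
    let tP , tR = T-allTerminate-++ (stack P) (stack R) t
    in •↓ (allTerminate⇒↓ p tP) (allTerminate⇒↓ q tR)

  branchesOf : Fin n → List (Actτ A × Expr)
  branchesOf Y = branches (gnf Y)

  data Step : List (Fin n) → Actτ A → List (Fin n) → Set where
    pop : ∀ {Y L a ξ} → (a , ξ) ∈ branchesOf Y → Step (Y ∷ L) a (stack ξ ++ L)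

  Step-++ : ∀ M → Step L a L′ → Step (L ++ M) a (L′ ++ M)
  Step-++ M (pop {L = L} {ξ = ξ} m) = subst (Step _ _) (sym (++-assoc (stack ξ) L M)) (pop m)

  Step-++⁻ : ∀ L {K} → Step (L ++ M) a K →
             (L ≡ [] × Step M a K) ⊎ Σ (List (Fin n)) λ L′ → Step L a L′ × K ≡ L′ ++ M
  Step-++⁻ []      s = inj₁ (refl , s)
  Step-++⁻ {M = M} (Y ∷ L) (pop {ξ = ξ} m) = inj₂ (stack ξ ++ L , pop m , sym (++-assoc (stack ξ) L M))

  step⇒Step : SeqNames Q → Q ⟶[ a ] Q₁ → SeqNames Q₁ × Step (stack Q) a (stack Q₁)
  step⇒Step (sname Y) (nameₜ st) with idle? Y
  ... | yes (_ , nsname ns) = ⊥-elim (noStep-stuck ns st)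
  ... | no _ = branch-seqNames (gnf Y) m , subst (Step _ _) (++-identityʳ _) (pop m)
    where m = step⇒branch (gnf Y) st
  step⇒Step (s• p q) (•ˡ st) =
    let s , ls = step⇒Step p st in s• s q , Step-++ _ ls
  step⇒Step (s• p q) (•ʳ t ns st) rewrite quiescent⇒stack-empty p t ns = step⇒Step q st

  Step⇒step : SeqNames Q → Step (stack Q) a L →
              Σ Expr λ Q₁ → Q ⟶[ a ] Q₁ × SeqNames Q₁ × stack Q₁ ≡ L
  Step⇒step s𝟏 ()
  Step⇒step (sname Y) with idle? Y
  ... | yes _ = λ ()
  ... | no _  = λ { (pop m) → _ , nameₜ (branch⇒step (gnf Y) m) , branch-seqNames (gnf Y) m
                                , sym (++-identityʳ _) }
  Step⇒step (s• {P} {R} p q) ls with Step-++⁻ (stack P) ls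
  ... | inj₁ (e , ls′) =
    let t , ns = stack-empty⇒quiescent p e
        R₁ , st , s , e′ = Step⇒step q ls′
    in R₁ , •ʳ t ns st , s , e′
  ... | inj₂ (L′ , ls′ , e) =
    let P₁ , st , s , e′ = Step⇒step p ls′
    in P₁ • R , •ˡ st , s• s q , trans (cong (_++ stack R) e′) (sym e)

  bit : Bool → Fin 2
  bit false = zero
  bit true  = suc zero

  bit-injective : ∀ {b b′} → bit b ≡ bit b′ → b ≡ b′
  bit-injective {false} {false} _ = refl
  bit-injective {true}  {true}  _ = refl

  symbol : Fin n → Bool → Fin (n * 2)
  symbol Y b = combine Y (bit b)

  symbol-injective : ∀ {Y Y′ b b′} → symbol Y b ≡ symbol Y′ b′ → Y ≡ Y′ × b ≡ b′
  symbol-injective {Y} {Y′} {b} {b′} e with combine-injective Y (bit b) Y′ (bit b′) e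
  ... | refl , e′ = refl , bit-injective e′

  -- The symbol of each name Y records allTerminate b for the names below Y,
  -- which is the control state after Y is popped.
  encode : Bool → List (Fin n) → List (Fin (n * 2))
  encode b []      = []
  encode b (Y ∷ L) = symbol Y (allTerminate b L) ∷ encode b L

  config : List (Fin n) → Fin 2 × List (Fin (n * 2))
  config L = bit (allTerminate true L) , encode true L

  encode-++ : ∀ b L M → encode b (L ++ M) ≡ encode (allTerminate b M) L ++ encode b M
  encode-++ b []      M = refl
  encode-++ b (Y ∷ L) M =
    cong₂ _∷_ (cong (symbol Y) (foldr-++ _ b L M)) (encode-++ b L M)

  config-++ : ∀ L M → config (L ++ M) ≡
              (bit (allTerminate (allTerminate true M) L) , encode (allTerminate true M) L ++ encode true M)
  config-++ L M = cong₂ _,_ (cong bit (foldr-++ _ true L M)) (encode-++ true L M)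

  Rule : Set
  Rule = Fin 2 × Fin (n * 2) × Actτ A × List (Fin (n * 2)) × Fin 2

  rule : Fin 2 → Fin n → Bool → Actτ A → Expr → Rule
  rule q Y b a ξ = q , symbol Y b , a , encode b (stack ξ) , bit (allTerminate b (stack ξ))

  bools : List Bool
  bools = false ∷ true ∷ []

  ∈-bools : ∀ b → b ∈ bools
  ∈-bools false = here refl
  ∈-bools true  = there (here refl)

  rulesAt : Fin 2 × Fin n × Bool → List Rule
  rulesAt (q , Y , b) = map (uncurry (rule q Y b)) (branchesOf Y)

  ruleIndices : List (Fin 2 × Fin n × Bool)
  ruleIndices = cartesianProduct (allFin 2) (cartesianProduct (allFin n) bools)

  rules : List Rule
  rules = concatMap rulesAt ruleIndices

  ∈-rules⁺ : ∀ {q Y b a ξ} → (a , ξ) ∈ branchesOf Y → rule q Y b a ξ ∈ rules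
  ∈-rules⁺ {q} {Y} {b} m =
    ∈-concatMap⁺ rulesAt (lose (∈-cartesianProduct⁺ (∈-allFin q) (∈-cartesianProduct⁺ (∈-allFin Y) (∈-bools b)))
                       (∈-map⁺ _ m))

  data IsRule : Rule → Set where
    isRule : ∀ q Y b {a ξ} → (a , ξ) ∈ branchesOf Y → IsRule (rule q Y b a ξ)

  ∈-rules⁻ : ∀ {r} → r ∈ rules → IsRule r
  ∈-rules⁻ m with find (∈-concatMap⁻ rulesAt {xs = ruleIndices} m)
  ... | (q , Y , b) , _ , m′ with ∈-map⁻ (uncurry (rule q Y b)) m′
  ... | (a , ξ) , br , refl = isRule q Y b br

  machine : Fin n → PDA A
  machine X = record
    { nS = 2 ; Σₐ = map label rules ; nD = n * 2 ; trans = rules ; trans⊆Σ = ∈-map⁺ label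
    ; start = proj₁ (config (X ∷ [])) ; Z = symbol X true ; accept = ⁅ bit true ⁆ }
    where
      label : Rule → Actτ A
      label (_ , _ , a , _ , _) = a

  accepting : T b → bit b ∈ˢ ⁅ bit true ⁆
  accepting {true} _ = x∈⁅x⁆ (bit true)

  accepting⁻ : bit b ∈ˢ ⁅ bit true ⁆ → T b
  accepting⁻ {false} ()
  accepting⁻ {true}  _ = tt

  module _ (X : Fin n) where

    Step⇒pdaStep : Step L a L′ → PDAStep (machine X) (config L) a (config L′)
    Step⇒pdaStep (pop {L = L} {ξ = ξ} m) =
      subst (PDAStep (machine X) _ _) (sym (config-++ (stack ξ) L)) (pstep (∈-rules⁺ m))

    pdaStep⇒Step : ∀ {c a c′} → PDAStep (machine X) c a c′ → c ≡ config L →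
                   Σ (List (Fin n)) λ L′ → Step L a L′ × c′ ≡ config L′
    pdaStep⇒Step {L = L} (pstep m) e with ∈-rules⁻ m | L | e
    ... | isRule q Y b br | []     | ()
    ... | isRule q Y b {ξ = ξ} br | Y′ ∷ L | e with ∷-injective (cong proj₂ e)
    ... | e₁ , refl with symbol-injective e₁
    ... | refl , refl = stack ξ ++ L , pop br , sym (config-++ (stack ξ) L)

    Represents : State (𝒯 E (name X)) → State (𝒯ᴹ (machine X)) → Set
    Represents (Q , _) c = SeqNames Q × c ≡ config (stack Q)

    represents-bisimulation : IsBisimulationBetween (𝒯 E (name X)) (𝒯ᴹ (machine X)) Represents
    represents-bisimulation .IsBisimulationBetween.forth {s′ = Q₁ , _} (s , refl) st =
      let s₁ , ls = step⇒Step s st in config (stack Q₁) , Step⇒pdaStep ls , s₁ , refl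
    represents-bisimulation .IsBisimulationBetween.back {s = _ , r} (s , e) ps =
      let L′ , ls , e₁ = pdaStep⇒Step ps e
          Q₁ , st , s₁ , e₂ = Step⇒step s ls
      in (Q₁ , next r st) , st , s₁ , trans e₁ (cong config (sym e₂))
    represents-bisimulation .IsBisimulationBetween.term⇒ (s , refl) t = accepting (↓⇒allTerminate s t)
    represents-bisimulation .IsBisimulationBetween.term⇐ (s , refl) acc = allTerminate⇒↓ s (accepting⁻ acc)

    initially-represents : ¬ Idle X → Represents (init (𝒯 E (name X))) (init (𝒯ᴹ (machine X)))
    initially-represents active with idle? X
    ... | yes idle = ⊥-elim (active idle)
    ... | no _     = sname X , refl

  pushdown-bisimilar : ∀ X → Σ (PDA A) λ M → StronglyBisimilar (𝒯 E (name X)) (𝒯ᴹ M)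
  pushdown-bisimilar X with idle? X
  ... | yes (final , quiet) =
    halt , stuck-bisimilar (𝒯 E (name X)) (𝒯ᴹ halt) (noStep-stuck quiet) final halt-stuck ∈⊤
  ... | no active =
    machine X , bisimulation⇒bisimilar _ _ (Represents X) (represents-bisimulation X)
                                       (initially-represents X active)

theorem2 : {A : Set} {n : ℕ} (E : Spec A n) → Guarded E → GreibachNF E →
    (X : Fin n) → Σ (PDA A) λ M → StronglyBisimilar (𝒯 E (name X)) (𝒯ᴹ M)
theorem2 E _ gnf = PushdownConstruction.pushdown-bisimilar E gnf
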